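{- Let $N\ge1$ and $0\le a\le b-1$ be integers, and let $n$ be an integer with $0\leq n\leq bN$ and $n\equiv a \pmod b$. Then $n\notin \mathcal E(A)\cup (Nb- \mathcal E(b-A))$ if and only if $n_{a,A}\leq n\leq bN-n_{b-a,b-A}$. Consequently, there exist such integers $n$ (i.e. $0\le n\le bN$, $n\equiv a\pmod b$, $n\notin \mathcal E(A)\cup (Nb- \mathcal E(b-A))$) if and only if $N\geq N_{a,A}^*:= \tfrac 1b (n_{a,A}+n_{b-a,b-A})$.
   Context: $A$ is a finite set of integers with smallest element $0$, largest element $b\ge1$, and gcd of its elements equal to $1$. $\mathbb N=\{0,1,2,\dots\}$. For a finite set $X$ of nonnegative integers, $\mathcal P(X)=\{\sum_{x\in X} n_x x: n_x\in\mathbb N\}$ and $\mathcal E(X)=\mathbb N\setminus\mathcal P(X)$. $b-A=\{b-x:x\in A\}$; $m-Y=\{m-y:y\in Y\}$. For an integer $c$, $n_{c,A}=\min\{n\ge 0: n\equiv c\pmod b,\ n\in\mathcal P(A)\}$, and $n_{c,b-A}$ is defined in the same way with $b-A$ in place of $A$ (same modulus $b$). -}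

module Defs where

open import Data.Nat using (ℕ; _+_; _*_; _∸_; _≤_; _<_)
open import Data.Nat.GCD using (gcd)
open import Data.List using (List; length; zipWith; foldr; map)
open import Data.Nat.ListAction using (sum)
open import Data.List.Membership.Propositional using (_∈_)
open import Data.List.Relation.Unary.All using (All)
open import Data.Product using (Σ; ∃; _×_)
open import Data.Sum using (_⊎_)
open import Relation.Nullary using (¬_)
open import Relation.Binary.PropositionalEquality using (_≡_)
import Data.Integer as ℤ
import Data.Integer.Divisibility as ℤD

-- Sets of nonnegative integers are represented as lists of ℕ.

𝒫 : List ℕ → ℕ → Set
𝒫 X n = Σ (List ℕ) λ cs → length cs ≡ length X × sum (zipWith _*_ cs X) ≡ n

ℰ : List ℕ → ℕ → Set
ℰ X n = ¬ 𝒫 X n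

_≡_[mod_] : ℕ → ℕ → ℕ → Set
x ≡ y [mod m ] = (ℤ.+ m) ℤD.∣ ((ℤ.+ x) ℤ.- (ℤ.+ y))

-- m - Y = { m - y : y ∈ Y }, membership of a natural number n
InShift : ℕ → (ℕ → Set) → ℕ → Set
InShift m Y n = ∃ λ y → Y y × n + y ≡ m

-- b - A (used only when all elements of A are ≤ b)
reflect : ℕ → List ℕ → List ℕ
reflect b A = map (b ∸_) A

StandingA : List ℕ → ℕ → Set
StandingA A b = 1 ≤ b × 0 ∈ A × b ∈ A × All (_≤ b) A × foldr gcd 0 A ≡ 1

IsNmin : List ℕ → ℕ → ℕ → ℕ → Set
IsNmin X b c m = (m ≡ c [mod b ]) × 𝒫 X m ×
  (∀ k → k ≡ c [mod b ] → 𝒫 X k → m ≤ k)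

{-# OPTIONS --safe #-}
-- Since b ∈ A, 𝒫(A) is closed under adding b, so inside the residue class of a it is
-- exactly {n ≥ n_{a,A}}; the same holds for b − A, which contains b because 0 ∈ A.
-- For n ≤ Nb, n lies in Nb − ℰ(b − A) iff Nb − n ∉ 𝒫(b − A), and Nb − n is in the class
-- of b − a, so n avoids both exceptional sets iff n_{a,A} ≤ n ≤ Nb − n_{b−a,b−A}.
-- The gcd hypothesis only serves to make n_{a,A} and n_{b−a,b−A} exist, which is assumed.
module Submission where

open import Defs
open import Data.Nat using (ℕ; _+_; _*_; _∸_; _≤_; _<_)
open import Data.Product using (∃; _×_)
open import Data.Sum using (_⊎_)
open import Relation.Nullary using (¬_)
open import Data.List using (List)
open import Function.Bundles using (_⇔_)

open import Data.Nat using (zero; suc; _≤?_)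
open import Data.Nat.Properties
open import Data.Nat.Divisibility using (_∣_; divides; ∣-refl; m∣m*n)
open import Data.Nat.ListAction using (sum)
open import Data.List using (_∷_; []; zipWith)
open import Data.List.Membership.Propositional using (_∈_)
open import Data.List.Membership.Propositional.Properties using (∈-map⁺)
open import Data.List.Relation.Unary.Any using (here; there)
open import Data.Product using (_,_; uncurry)
open import Data.Product.Function.NonDependent.Propositional using (_×-⇔_)
open import Data.Sum using (inj₁; inj₂)
open import Function using (_∘_)
open import Function.Bundles using (mk⇔; Equivalence)
open import Function.Construct.Composition using (_⇔-∘_)
open import Relation.Nullary.Decidable using (decidable-stable)
open import Relation.Nullary.Negation using (_¬-⊎_)
open import Relation.Binary.PropositionalEquality
open import Algebra.Properties.CommutativeSemigroup +-commutativeSemigroup using (interchange)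
import Data.Integer as ℤ
import Data.Integer.Properties as ℤ
import Data.Integer.Divisibility.Signed as ℤ
import Data.Integer.Tactic.RingSolver as ℤ

𝒫-0 : ∀ X → 𝒫 X 0
𝒫-0 [] = [] , refl , refl
𝒫-0 (x ∷ X) with 𝒫-0 X
... | cs , len , eq = 0 ∷ cs , cong suc len , eq

𝒫-∈ : ∀ {x X} → x ∈ X → 𝒫 X x
𝒫-∈ {x} {_ ∷ X} (here refl) with 𝒫-0 X
... | cs , len , eq =
  1 ∷ cs , cong suc len , trans (cong (1 * x +_) eq) (trans (+-identityʳ (1 * x)) (*-identityˡ x))
𝒫-∈ {X = _ ∷ X} (there x∈X) with 𝒫-∈ x∈X
... | cs , len , eq = 0 ∷ cs , cong suc len , eq

𝒫-+ : ∀ {X m n} → 𝒫 X m → 𝒫 X n → 𝒫 X (m + n)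
𝒫-+ {[]} ([] , _ , refl) ([] , _ , refl) = [] , refl , refl
𝒫-+ {x ∷ X} (c ∷ cs , lc , refl) (d ∷ ds , ld , refl)
  with 𝒫-+ {X} (cs , suc-injective lc , refl) (ds , suc-injective ld , refl)
... | es , le , eq = c + d ∷ es , cong suc le , (begin
  (c + d) * x + sum (zipWith _*_ es X)  ≡⟨ cong₂ _+_ (*-distribʳ-+ x c d) eq ⟩
  (c * x + d * x) + (S + T)             ≡⟨ interchange (c * x) (d * x) S T ⟩
  (c * x + S) + (d * x + T)             ∎)
  where
  open ≡-Reasoning
  S = sum (zipWith _*_ cs X)
  T = sum (zipWith _*_ ds X)

𝒫-* : ∀ {X n} k → 𝒫 X n → 𝒫 X (k * n)
𝒫-* {X} zero _ = 𝒫-0 X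
𝒫-* (suc k) P = 𝒫-+ P (𝒫-* k P)

-- x ≡ y [mod b] unfolds to b ∣ ℤ.∣ + x - + y ∣, through which Agda cannot infer x and y;
-- these conversions to signed divisibility fix them explicitly.
≡[mod]⇒signed-∣ : ∀ {b} x y → x ≡ y [mod b ] → ℤ.+ b ℤ.∣ ℤ.+ x ℤ.- ℤ.+ y
≡[mod]⇒signed-∣ _ _ = ℤ.∣ᵤ⇒∣

signed-∣⇒≡[mod] : ∀ {b} x y → ℤ.+ b ℤ.∣ ℤ.+ x ℤ.- ℤ.+ y → x ≡ y [mod b ]
signed-∣⇒≡[mod] _ _ = ℤ.∣⇒∣ᵤ

≡[mod]-sym : ∀ {b x y} → x ≡ y [mod b ] → y ≡ x [mod b ]
≡[mod]-sym {b} {x} {y} = subst (b ∣_) (ℤ.∣i-j∣≡∣j-i∣ (ℤ.+ x) (ℤ.+ y))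

≡[mod]-trans : ∀ {b x y z} → x ≡ y [mod b ] → y ≡ z [mod b ] → x ≡ z [mod b ]
≡[mod]-trans {b} {x} {y} {z} x≡y y≡z = signed-∣⇒≡[mod] x z (subst (ℤ.+ b ℤ.∣_)
  (telescope (ℤ.+ x) (ℤ.+ y) (ℤ.+ z))
  (ℤ.∣m∣n⇒∣m+n (≡[mod]⇒signed-∣ x y x≡y) (≡[mod]⇒signed-∣ y z y≡z)))
  where
  telescope : ∀ x y z → (x ℤ.- y) ℤ.+ (y ℤ.- z) ≡ x ℤ.- z
  telescope = ℤ.solve-∀

≡[mod]-+-cancelʳ : ∀ {b} x y z w → (x + z) ≡ (y + w) [mod b ] → z ≡ w [mod b ] → x ≡ y [mod b ]
≡[mod]-+-cancelʳ {b} x y z w x+z≡y+w z≡w = signed-∣⇒≡[mod] x y (subst (ℤ.+ b ℤ.∣_)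
  (cancel (ℤ.+ x) (ℤ.+ y) (ℤ.+ z) (ℤ.+ w))
  (ℤ.∣m∣n⇒∣m-n b∣[x+z]-[y+w] (≡[mod]⇒signed-∣ z w z≡w)))
  where
  cancel : ∀ x y z w → ((x ℤ.+ z) ℤ.- (y ℤ.+ w)) ℤ.- (z ℤ.- w) ≡ x ℤ.- y
  cancel = ℤ.solve-∀
  b∣[x+z]-[y+w] : ℤ.+ b ℤ.∣ (ℤ.+ x ℤ.+ ℤ.+ z) ℤ.- (ℤ.+ y ℤ.+ ℤ.+ w)
  b∣[x+z]-[y+w] = subst (ℤ.+ b ℤ.∣_) (cong₂ ℤ._-_ (ℤ.pos-+ x z) (ℤ.pos-+ y w))
    (≡[mod]⇒signed-∣ (x + z) (y + w) x+z≡y+w)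

∣⇒≡[mod] : ∀ {b x y} → b ∣ x → b ∣ y → x ≡ y [mod b ]
∣⇒≡[mod] {x = x} {y} b∣x b∣y =
  signed-∣⇒≡[mod] x y (ℤ.∣m∣n⇒∣m-n (ℤ.∣ᵤ⇒∣ {i = ℤ.+ x} b∣x) (ℤ.∣ᵤ⇒∣ {i = ℤ.+ y} b∣y))

≡[mod]⇒∣∸ : ∀ {b x y} → y ≤ x → x ≡ y [mod b ] → b ∣ x ∸ y
≡[mod]⇒∣∸ {b} {x} {y} y≤x =
  subst (b ∣_) (cong ℤ.∣_∣ (trans (ℤ.m-n≡m⊖n x y) (ℤ.⊖-≥ y≤x)))

∸-≡[mod]-∸ : ∀ {b m n a} → b ∣ m → n ≤ m → a ≤ b → n ≡ a [mod b ] →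
  (m ∸ n) ≡ (b ∸ a) [mod b ]
∸-≡[mod]-∸ {b} {m} {n} {a} b∣m n≤m a≤b = ≡[mod]-+-cancelʳ (m ∸ n) (b ∸ a) n a
  (subst₂ (λ x y → x ≡ y [mod b ]) (sym (m∸n+n≡m n≤m)) (sym (m∸n+n≡m a≤b))
    (∣⇒≡[mod] b∣m ∣-refl))

𝒫-≡[mod]-upward : ∀ {X b m n} → b ∈ X → 𝒫 X m → n ≡ m [mod b ] → m ≤ n → 𝒫 X n
𝒫-≡[mod]-upward {X} {b} {m} {n} b∈X P n≡m m≤n with ≡[mod]⇒∣∸ m≤n n≡m
... | divides k n∸m≡k*b = subst (𝒫 X) m+k*b≡n (𝒫-+ P (𝒫-* k (𝒫-∈ b∈X)))
  where
  m+k*b≡n : m + k * b ≡ n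
  m+k*b≡n = trans (cong (m +_) (sym n∸m≡k*b)) (m+[n∸m]≡n m≤n)

IsNmin⇒𝒫⇔≤ : ∀ {X b c n₀ n} → b ∈ X → IsNmin X b c n₀ → n ≡ c [mod b ] → 𝒫 X n ⇔ n₀ ≤ n
IsNmin⇒𝒫⇔≤ {c = c} {n₀} {n} b∈X (n₀≡c , P₀ , n₀-least) n≡c = mk⇔ (n₀-least n n≡c)
  (𝒫-≡[mod]-upward b∈X P₀ (≡[mod]-trans {x = n} {c} {n₀} n≡c (≡[mod]-sym {x = n₀} {c} n₀≡c)))

IsNmin⇒¬ℰ⇔≤ : ∀ {X b c n₀ n} → b ∈ X → IsNmin X b c n₀ → n ≡ c [mod b ] → (¬ ℰ X n) ⇔ n₀ ≤ n
IsNmin⇒¬ℰ⇔≤ {c = c} {n₀} {n} b∈X n₀-min n≡c = mk⇔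
  (λ ¬¬P → decidable-stable (n₀ ≤? n) (λ n₀≰n → ¬¬P (n₀≰n ∘ to)))
  (λ n₀≤n ℰn → ℰn (from n₀≤n))
  where open Equivalence (IsNmin⇒𝒫⇔≤ {c = c} b∈X n₀-min n≡c)

¬InShift⇔¬∸ : ∀ {m n} {Y : ℕ → Set} → n ≤ m → (¬ InShift m Y n) ⇔ (¬ Y (m ∸ n))
¬InShift⇔¬∸ {m} {n} {Y} n≤m = mk⇔
  (λ ¬shift Y[m∸n] → ¬shift (m ∸ n , Y[m∸n] , m+[n∸m]≡n n≤m))
  (λ { ¬Y[m∸n] (y , Yy , n+y≡m) → ¬Y[m∸n] (subst Y (sym (m∸n≡y n+y≡m)) Yy) })
  where
  m∸n≡y : ∀ {y} → n + y ≡ m → m ∸ n ≡ y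
  m∸n≡y {y} refl = m+n∸m≡n n y

≤∸⇔+≤ : ∀ {k m n} → n ≤ m → k ≤ m ∸ n ⇔ n + k ≤ m
≤∸⇔+≤ {k} {m} {n} n≤m = mk⇔
  (λ k≤m∸n → subst (_≤ m) (+-comm k n) (m≤o∸n⇒m+n≤o k n≤m k≤m∸n))
  (λ n+k≤m → m+n≤o⇒m≤o∸n k (subst (_≤ m) (+-comm n k) n+k≤m))

IsNmin⇒¬InShift-ℰ⇔≤ : ∀ {X b a n₂ m n} → b ∈ X → IsNmin X b (b ∸ a) n₂ → a ≤ b →
  b ∣ m → n ≤ m → n ≡ a [mod b ] → (¬ InShift m (ℰ X) n) ⇔ n + n₂ ≤ m
IsNmin⇒¬InShift-ℰ⇔≤ {b = b} {a} b∈X n₂-min a≤b b∣m n≤m n≡a =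
  ≤∸⇔+≤ n≤m
    ⇔-∘ (IsNmin⇒¬ℰ⇔≤ {c = b ∸ a} b∈X n₂-min (∸-≡[mod]-∸ b∣m n≤m a≤b n≡a)
    ⇔-∘ ¬InShift⇔¬∸ n≤m)

¬-⊎⇔ : ∀ {a b} {P : Set a} {Q : Set b} → (¬ (P ⊎ Q)) ⇔ (¬ P × ¬ Q)
¬-⊎⇔ = mk⇔ (λ ¬P⊎Q → ¬P⊎Q ∘ inj₁ , ¬P⊎Q ∘ inj₂) (uncurry _¬-⊎_)

mainTheorem6 : (A : List ℕ) (b : ℕ) → StandingA A b →
    (N : ℕ) → 1 ≤ N → (a : ℕ) → a < b →
    (n₁ n₂ : ℕ) → IsNmin A b a n₁ → IsNmin (reflect b A) b (b ∸ a) n₂ →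
    ((n : ℕ) → n ≤ b * N → n ≡ a [mod b ] →
      ((¬ (ℰ A n ⊎ InShift (N * b) (ℰ (reflect b A)) n)) ⇔ (n₁ ≤ n × n + n₂ ≤ b * N)))
    ×
    ((∃ λ n → n ≤ b * N × n ≡ a [mod b ] × ¬ (ℰ A n ⊎ InShift (N * b) (ℰ (reflect b A)) n))
      ⇔ n₁ + n₂ ≤ b * N)
mainTheorem6 A b (_ , 0∈A , b∈A , _) N _ a a<b n₁ n₂ n₁-min@(n₁≡a , _) n₂-min =
  window , window-nonempty
  where
  b∈b-A : b ∈ reflect b A
  b∈b-A = ∈-map⁺ (b ∸_) 0∈A

  window : (n : ℕ) → n ≤ b * N → n ≡ a [mod b ] →
    (¬ (ℰ A n ⊎ InShift (N * b) (ℰ (reflect b A)) n)) ⇔ (n₁ ≤ n × n + n₂ ≤ b * N)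
  window n n≤bN n≡a = (IsNmin⇒¬ℰ⇔≤ {c = a} b∈A n₁-min n≡a ×-⇔ upper) ⇔-∘ ¬-⊎⇔
    where
    upper : (¬ InShift (N * b) (ℰ (reflect b A)) n) ⇔ n + n₂ ≤ b * N
    upper rewrite *-comm N b =
      IsNmin⇒¬InShift-ℰ⇔≤ {a = a} b∈b-A n₂-min (<⇒≤ a<b) (m∣m*n N) n≤bN n≡a

  window-nonempty :
    (∃ λ n → n ≤ b * N × n ≡ a [mod b ] × ¬ (ℰ A n ⊎ InShift (N * b) (ℰ (reflect b A)) n))
      ⇔ n₁ + n₂ ≤ b * N
  window-nonempty = mk⇔
    (λ (n , n≤bN , n≡a , n∈window) →
      let (n₁≤n , n+n₂≤bN) = Equivalence.to (window n n≤bN n≡a) n∈window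
      in ≤-trans (+-monoˡ-≤ n₂ n₁≤n) n+n₂≤bN)
    (λ n₁+n₂≤bN → let n₁≤bN = ≤-trans (m≤m+n n₁ n₂) n₁+n₂≤bN
      in n₁ , n₁≤bN , n₁≡a , Equivalence.from (window n₁ n₁≤bN n₁≡a) (≤-refl , n₁+n₂≤bN))
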